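{- Let $p$ be a prime and $k$ a positive integer such that for every $k$-element subset $\mathcal{K}\subset\mathbb{Z}_p$, every element of $\mathbb{Z}_p$ is the sum of the elements of some subset of $\mathcal{K}$. Let $q=mp$ with $m>1$ an integer, and let $\mathcal{B}\subset\mathbb{Z}_q$ with $|\mathcal{B}|>4k$, the elements of $\mathcal{B}$ pairwise distinct modulo $p$, and not all elements of $\mathcal{B}$ multiples of $m$. Suppose in addition that there is no subset $\mathcal{A}\subset\mathcal{B}$ with $\Sigma(\mathcal{A})\equiv 0\pmod p$ and $\Sigma(\mathcal{A})\not\equiv0\pmod q$. Then for every $x\in\mathbb{Z}_p$ there exists $f(x)\in\mathbb{Z}_q$ such that whenever $\mathcal{V}\subset\mathcal{B}$ with $|\mathcal{V}|\le k$ and $\Sigma(\mathcal{V})\equiv x\pmod p$, we have $\Sigma(\mathcal{V})\equiv f(x)\pmod q$. This defines a function $f:\mathbb{Z}_p\to\mathbb{Z}_q$.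
   Context: $\mathbb{Z}_q=\mathbb{Z}/q\mathbb{Z}$; reduction modulo $p$ is the natural map $\mathbb{Z}_q\to\mathbb{Z}_p$. For a finite set $\mathcal{A}$, $\Sigma(\mathcal{A})=\sum_{a\in\mathcal{A}}a$. -}

module Defs where

open import Data.Nat using (ℕ; zero; suc; _%_)
open import Data.Fin using (Fin; toℕ)
open import Data.Fin.Subset using (Subset)
open import Data.Fin.Subset.Properties using (_∈?_)
open import Data.List using (List; map; filter)
open import Data.Nat.ListAction using (sum)
open import Data.List.Base using (allFin)

-- reduction of a natural number modulo n (for n = 0 it is the identity;
-- only used here with n > 0, where it is the usual remainder).
_modℕ_ : ℕ → ℕ → ℕ
a modℕ zero  = a
a modℕ suc n = a % suc n

-- For S ⊆ ℤ_n = Fin n: sum in ℕ of the representatives 0..n-1 of the members.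
-- The element Σ(S) ∈ ℤ_n is (sumSub S) modℕ n.
sumSub : ∀ {n} → Subset n → ℕ
sumSub {n} S = sum (map toℕ (filter (_∈? S) (allFin n)))

{-# OPTIONS --safe #-}
-- If V, W ⊆ B have at most k elements each and Σ V ≡ Σ W (mod p), then B ∖ (V ∪ W) still
-- has at least k elements (as 3k ≤ |B|). Their residues are k distinct elements of ℤ_p, so
-- by the hypothesis on p and k some of them form a set T with Σ T ≡ −Σ V (mod p). Then
-- T ∪ V and T ∪ W have sum ≡ 0 (mod p), hence ≡ 0 (mod q), and so Σ V ≡ Σ W (mod q).
-- Thus f(x) := Σ W mod q works for any single such W with Σ W ≡ x (mod p), and one
-- exists by the same hypothesis applied to any k elements of B.
module Submission where

open import Defs
open import Data.Empty using (⊥-elim)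
open import Data.Fin.Base using (Fin; zero; suc; toℕ)
open import Data.Fin.Properties using (suc-injective; toℕ-fromℕ<; 0≢1+n)
open import Data.Fin.Subset
  using (Subset; inside; outside; _∈_; _∉_; _⊆_; ∣_∣; ⊥; ⁅_⁆; _∪_; _∩_; _─_)
open import Data.Fin.Subset.Properties
  using (_∈?_; ∉⊥; ⊥⊆; ∣⊥∣≡0; x∈⁅x⁆; x∈⁅y⁆⇒x≡y; x∈p∪q⁺; x∈p∪q⁻; x∈p∩q⁺; x∈p∩q⁻; p∩q⊆p;
         p─q⊆p; s⊆s; ⊆-antisym; ⊆-trans; p⊆q⇒∣p∣≤∣q∣)
open import Data.List.Base using (List; []; _∷_; map; filter; allFin; tabulate)
open import Data.List.Properties using (map-tabulate; map-∘)
open import Data.Nat.Base using (ℕ; zero; suc; _+_; _*_; _∸_; _%_; _<_; _≤_; s≤s; NonZero)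
open import Data.Nat.DivMod using (_mod_; m%n<n; %-distribˡ-+; m%n%n≡m%n; n%n≡0; %-remove-+ˡ)
open import Data.Nat.Divisibility using (_∣_; m%n≡0⇒n∣m)
open import Data.Nat.ListAction using (sum)
open import Data.Nat.Primality using (Prime)
open import Data.Nat.Properties
  using (_≟_; +-identityʳ; +-assoc; +-suc; ≤-refl; ≤-reflexive; ≤-trans; <⇒≤; n≤1+n; m≤m+n;
         +-monoʳ-≤; +-monoˡ-≤; +-mono-≤; +-cancelʳ-≤; m∸n+n≡m; *-monoˡ-≤; +-commutativeSemigroup;
         module ≤-Reasoning)
open import Algebra.Properties.CommutativeSemigroup +-commutativeSemigroup
  using (x∙yz≈y∙xz; xy∙z≈xz∙y)
open import Data.Product using (Σ; _×_; _,_; ∃-syntax; proj₂)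
open import Data.Sum using (inj₁; inj₂; [_,_])
import Data.Vec.Base as Vec
open import Data.Vec.Base using ([]; _∷_; here; there; lookup)
open import Data.Vec.Properties using (lookup∘tabulate; []=⇒lookup; lookup⇒[]=)
open import Function.Base using (_∘_; id; const)
open import Relation.Nullary using (¬_; yes; no)
open import Relation.Nullary.Decidable using (decidable-stable)
open import Relation.Binary.PropositionalEquality
  using (_≡_; _≢_; refl; sym; trans; cong; cong₂; subst₂; module ≡-Reasoning)

private
  variable
    m n : ℕ

sumOver : Subset n → (Fin n → ℕ) → ℕ
sumOver []            g = 0
sumOver (inside  ∷ S) g = g zero + sumOver S (g ∘ suc)
sumOver (outside ∷ S) g = sumOver S (g ∘ suc)

∣S∣≡sumOver-1 : (S : Subset n) → ∣ S ∣ ≡ sumOver S (const 1)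
∣S∣≡sumOver-1 []            = refl
∣S∣≡sumOver-1 (inside  ∷ S) = cong suc (∣S∣≡sumOver-1 S)
∣S∣≡sumOver-1 (outside ∷ S) = ∣S∣≡sumOver-1 S

filter-∈?-∷-map-suc : ∀ s (S : Subset n) (xs : List (Fin n)) →
  filter (_∈? s ∷ S) (map suc xs) ≡ map suc (filter (_∈? S) xs)
filter-∈?-∷-map-suc s S []       = refl
filter-∈?-∷-map-suc s S (x ∷ xs) with x ∈? S
... | yes _ = cong (suc x ∷_) (filter-∈?-∷-map-suc s S xs)
... | no  _ = filter-∈?-∷-map-suc s S xs

sum-filter-∈?-allFin : (S : Subset n) (g : Fin n → ℕ) →
  sum (map g (filter (_∈? S) (allFin n))) ≡ sumOver S g
sum-filter-∈?-tabulate-suc : ∀ s (S : Subset n) (g : Fin (suc n) → ℕ) →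
  sum (map g (filter (_∈? s ∷ S) (tabulate suc))) ≡ sumOver S (g ∘ suc)

sum-filter-∈?-allFin []            g = refl
sum-filter-∈?-allFin (inside  ∷ S) g = cong (g zero +_) (sum-filter-∈?-tabulate-suc inside S g)
sum-filter-∈?-allFin (outside ∷ S) g = sum-filter-∈?-tabulate-suc outside S g

sum-filter-∈?-tabulate-suc {n} s S g = begin
  sum (map g (filter (_∈? s ∷ S) (tabulate suc)))
    ≡⟨ cong (sum ∘ map g ∘ filter (_∈? s ∷ S)) (map-tabulate id suc) ⟨
  sum (map g (filter (_∈? s ∷ S) (map suc (allFin n))))
    ≡⟨ cong (sum ∘ map g) (filter-∈?-∷-map-suc s S (allFin n)) ⟩
  sum (map g (map suc (filter (_∈? S) (allFin n))))
    ≡⟨ cong sum (map-∘ (filter (_∈? S) (allFin n))) ⟨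
  sum (map (g ∘ suc) (filter (_∈? S) (allFin n)))
    ≡⟨ sum-filter-∈?-allFin S (g ∘ suc) ⟩
  sumOver S (g ∘ suc)
    ∎
  where open ≡-Reasoning

sumSub≡sumOver-toℕ : (S : Subset n) → sumSub S ≡ sumOver S toℕ
sumSub≡sumOver-toℕ S = sum-filter-∈?-allFin S toℕ

sumOver-⊥ : (g : Fin n → ℕ) → sumOver ⊥ g ≡ 0
sumOver-⊥ {zero}  g = refl
sumOver-⊥ {suc n} g = sumOver-⊥ (g ∘ suc)

sumOver-⁅x⁆ : (x : Fin n) (g : Fin n → ℕ) → sumOver ⁅ x ⁆ g ≡ g x
sumOver-⁅x⁆ zero    g = trans (cong (g zero +_) (sumOver-⊥ (g ∘ suc))) (+-identityʳ (g zero))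
sumOver-⁅x⁆ (suc x) g = sumOver-⁅x⁆ x (g ∘ suc)

Disjoint : Subset n → Subset n → Set
Disjoint S T = ∀ {x} → x ∈ S → x ∉ T

drop-∷-Disjoint : ∀ {s t} {S T : Subset n} → Disjoint (s ∷ S) (t ∷ T) → Disjoint S T
drop-∷-Disjoint S#T x∈S x∈T = S#T (there x∈S) (there x∈T)

sumOver-∪ : (S T : Subset n) → Disjoint S T → (g : Fin n → ℕ) →
  sumOver (S ∪ T) g ≡ sumOver S g + sumOver T g
sumOver-∪ []            []            S#T g = refl
sumOver-∪ (inside  ∷ S) (inside  ∷ T) S#T g = ⊥-elim (S#T here here)
sumOver-∪ (inside  ∷ S) (outside ∷ T) S#T g =
  trans (cong (g zero +_) (sumOver-∪ S T (drop-∷-Disjoint S#T) (g ∘ suc)))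
        (sym (+-assoc (g zero) _ _))
sumOver-∪ (outside ∷ S) (inside  ∷ T) S#T g =
  trans (cong (g zero +_) (sumOver-∪ S T (drop-∷-Disjoint S#T) (g ∘ suc)))
        (x∙yz≈y∙xz (g zero) (sumOver S (g ∘ suc)) _)
sumOver-∪ (outside ∷ S) (outside ∷ T) S#T g = sumOver-∪ S T (drop-∷-Disjoint S#T) (g ∘ suc)

sumSub-∪ : (S T : Subset n) → Disjoint S T → sumSub (S ∪ T) ≡ sumSub S + sumSub T
sumSub-∪ S T S#T = begin
  sumSub (S ∪ T)                  ≡⟨ sumSub≡sumOver-toℕ (S ∪ T) ⟩
  sumOver (S ∪ T) toℕ             ≡⟨ sumOver-∪ S T S#T toℕ ⟩
  sumOver S toℕ + sumOver T toℕ   ≡⟨ cong₂ _+_ (sumSub≡sumOver-toℕ S) (sumSub≡sumOver-toℕ T) ⟨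
  sumSub S + sumSub T             ∎
  where open ≡-Reasoning

image : (Fin m → Fin n) → Subset m → Subset n
image f []            = ⊥
image f (inside  ∷ S) = ⁅ f zero ⁆ ∪ image (f ∘ suc) S
image f (outside ∷ S) = image (f ∘ suc) S

∈-image⁺ : (f : Fin m → Fin n) {S : Subset m} {x : Fin m} → x ∈ S → f x ∈ image f S
∈-image⁺ f {inside  ∷ S} here        = x∈p∪q⁺ (inj₁ (x∈⁅x⁆ (f zero)))
∈-image⁺ f {inside  ∷ S} (there x∈S) = x∈p∪q⁺ (inj₂ (∈-image⁺ (f ∘ suc) x∈S))
∈-image⁺ f {outside ∷ S} (there x∈S) = ∈-image⁺ (f ∘ suc) x∈S

∈-image⁻ : (f : Fin m → Fin n) (S : Subset m) {y : Fin n} → y ∈ image f S →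
  ∃[ x ] x ∈ S × f x ≡ y
∈-image⁻ f []            y∈ = ⊥-elim (∉⊥ y∈)
∈-image⁻ f (inside  ∷ S) y∈ with x∈p∪q⁻ ⁅ f zero ⁆ (image (f ∘ suc) S) y∈
... | inj₁ y∈⁅f0⁆ = zero , here , sym (x∈⁅y⁆⇒x≡y (f zero) y∈⁅f0⁆)
... | inj₂ y∈img  with ∈-image⁻ (f ∘ suc) S y∈img
...   | x , x∈S , fx≡y = suc x , there x∈S , fx≡y
∈-image⁻ f (outside ∷ S) y∈ with ∈-image⁻ (f ∘ suc) S y∈
... | x , x∈S , fx≡y = suc x , there x∈S , fx≡y

InjectiveOn : (Fin m → Fin n) → Subset m → Set
InjectiveOn f S = ∀ {x y} → x ∈ S → y ∈ S → f x ≡ f y → x ≡ y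

drop-∷-InjectiveOn : ∀ {f : Fin (suc m) → Fin n} {s S} →
  InjectiveOn f (s ∷ S) → InjectiveOn (f ∘ suc) S
drop-∷-InjectiveOn inj x∈S y∈S fx≡fy = suc-injective (inj (there x∈S) (there y∈S) fx≡fy)

sumOver-image : (f : Fin m → Fin n) (S : Subset m) → InjectiveOn f S → (g : Fin n → ℕ) →
  sumOver (image f S) g ≡ sumOver S (g ∘ f)
sumOver-image f []            inj g = sumOver-⊥ g
sumOver-image f (inside  ∷ S) inj g = begin
  sumOver (⁅ f zero ⁆ ∪ image (f ∘ suc) S) g
    ≡⟨ sumOver-∪ _ _ fresh g ⟩
  sumOver ⁅ f zero ⁆ g + sumOver (image (f ∘ suc) S) g
    ≡⟨ cong₂ _+_ (sumOver-⁅x⁆ (f zero) g) (sumOver-image (f ∘ suc) S (drop-∷-InjectiveOn inj) g) ⟩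
  g (f zero) + sumOver S (g ∘ f ∘ suc)
    ∎
  where
  open ≡-Reasoning
  fresh : Disjoint ⁅ f zero ⁆ (image (f ∘ suc) S)
  fresh y∈⁅f0⁆ y∈img with ∈-image⁻ (f ∘ suc) S y∈img
  ... | x , x∈S , refl = 0≢1+n (inj here (there x∈S) (sym (x∈⁅y⁆⇒x≡y (f zero) y∈⁅f0⁆)))
sumOver-image f (outside ∷ S) inj g = sumOver-image (f ∘ suc) S (drop-∷-InjectiveOn inj) g

∣image∣ : (f : Fin m → Fin n) (S : Subset m) → InjectiveOn f S → ∣ image f S ∣ ≡ ∣ S ∣
∣image∣ f S inj = begin
  ∣ image f S ∣                 ≡⟨ ∣S∣≡sumOver-1 (image f S) ⟩
  sumOver (image f S) (const 1) ≡⟨ sumOver-image f S inj (const 1) ⟩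
  sumOver S (const 1)           ≡⟨ ∣S∣≡sumOver-1 S ⟨
  ∣ S ∣                         ∎
  where open ≡-Reasoning

preimage : (Fin m → Fin n) → Subset n → Subset m
preimage f T = Vec.tabulate (lookup T ∘ f)

∈-preimage⁺ : (f : Fin m → Fin n) {T : Subset n} {x : Fin m} → f x ∈ T → x ∈ preimage f T
∈-preimage⁺ f {T} {x} fx∈T =
  lookup⇒[]= x (preimage f T) (trans (lookup∘tabulate (lookup T ∘ f) x) ([]=⇒lookup fx∈T))

∈-preimage⁻ : (f : Fin m → Fin n) {T : Subset n} {x : Fin m} → x ∈ preimage f T → f x ∈ T
∈-preimage⁻ f {T} {x} x∈ =
  lookup⇒[]= (f x) T (trans (sym (lookup∘tabulate (lookup T ∘ f) x)) ([]=⇒lookup x∈))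

image-∩-preimage : (f : Fin m → Fin n) (S : Subset m) {A : Subset n} → A ⊆ image f S →
  image f (S ∩ preimage f A) ≡ A
image-∩-preimage f S {A} A⊆fS = ⊆-antisym image⊆A A⊆image
  where
  image⊆A : image f (S ∩ preimage f A) ⊆ A
  image⊆A y∈ with ∈-image⁻ f (S ∩ preimage f A) y∈
  ... | x , x∈ , refl = ∈-preimage⁻ f (proj₂ (x∈p∩q⁻ S (preimage f A) x∈))
  A⊆image : A ⊆ image f (S ∩ preimage f A)
  A⊆image y∈A with ∈-image⁻ f S (A⊆fS y∈A)
  ... | x , x∈S , refl = ∈-image⁺ f (x∈p∩q⁺ (x∈S , ∈-preimage⁺ f y∈A))

⊆-ofSize : ∀ k (S : Subset n) → k ≤ ∣ S ∣ → ∃[ T ] T ⊆ S × ∣ T ∣ ≡ k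
⊆-ofSize {n} zero S _ = ⊥ , ⊥⊆ , ∣⊥∣≡0 n
⊆-ofSize (suc k) (inside  ∷ S) (s≤s k≤∣S∣) with ⊆-ofSize k S k≤∣S∣
... | T , T⊆S , ∣T∣≡k = inside ∷ T , s⊆s T⊆S , cong suc ∣T∣≡k
⊆-ofSize (suc k) (outside ∷ S) k<∣S∣ with ⊆-ofSize (suc k) S k<∣S∣
... | T , T⊆S , ∣T∣≡k = outside ∷ T , s⊆s T⊆S , ∣T∣≡k

x∈p─q⇒x∉q : (P Q : Subset n) {x : Fin n} → x ∈ P ─ Q → x ∉ Q
x∈p─q⇒x∉q (inside ∷ P) (outside ∷ Q) here        ()
x∈p─q⇒x∉q (_      ∷ P) (_       ∷ Q) (there x∈) (there x∈Q) = x∈p─q⇒x∉q P Q x∈ x∈Q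

p─q─r⊆p : (P Q R : Subset n) → P ─ Q ─ R ⊆ P
p─q─r⊆p P Q R = ⊆-trans (p─q⊆p (P ─ Q) R) (p─q⊆p P Q)

∣p∣≤∣p─q∣+∣q∣ : (P Q : Subset n) → ∣ P ∣ ≤ ∣ P ─ Q ∣ + ∣ Q ∣
∣p∣≤∣p─q∣+∣q∣ []            []            = ≤-refl
∣p∣≤∣p─q∣+∣q∣ (inside  ∷ P) (inside  ∷ Q) =
  ≤-trans (s≤s (∣p∣≤∣p─q∣+∣q∣ P Q)) (≤-reflexive (sym (+-suc _ _)))
∣p∣≤∣p─q∣+∣q∣ (inside  ∷ P) (outside ∷ Q) = s≤s (∣p∣≤∣p─q∣+∣q∣ P Q)
∣p∣≤∣p─q∣+∣q∣ (outside ∷ P) (inside  ∷ Q) =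
  ≤-trans (∣p∣≤∣p─q∣+∣q∣ P Q) (+-monoʳ-≤ ∣ P ─ Q ∣ (n≤1+n ∣ Q ∣))
∣p∣≤∣p─q∣+∣q∣ (outside ∷ P) (outside ∷ Q) = ∣p∣≤∣p─q∣+∣q∣ P Q

k≤∣B─V─W∣ : ∀ {k} (B V W : Subset n) → 3 * k ≤ ∣ B ∣ → ∣ V ∣ ≤ k → ∣ W ∣ ≤ k →
  k ≤ ∣ B ─ V ─ W ∣
k≤∣B─V─W∣ {k = k} B V W 3k≤∣B∣ ∣V∣≤k ∣W∣≤k = +-cancelʳ-≤ (k + k) k ∣ B ─ V ─ W ∣ (begin
  k + (k + k)                       ≡⟨ cong (λ z → k + (k + z)) (+-identityʳ k) ⟨
  3 * k                             ≤⟨ 3k≤∣B∣ ⟩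
  ∣ B ∣                             ≤⟨ ∣p∣≤∣p─q∣+∣q∣ B V ⟩
  ∣ B ─ V ∣ + ∣ V ∣                 ≤⟨ +-monoˡ-≤ ∣ V ∣ (∣p∣≤∣p─q∣+∣q∣ (B ─ V) W) ⟩
  ∣ B ─ V ─ W ∣ + ∣ W ∣ + ∣ V ∣     ≤⟨ +-mono-≤ (+-monoʳ-≤ ∣ B ─ V ─ W ∣ ∣W∣≤k) ∣V∣≤k ⟩
  ∣ B ─ V ─ W ∣ + k + k             ≡⟨ +-assoc ∣ B ─ V ─ W ∣ k k ⟩
  ∣ B ─ V ─ W ∣ + (k + k)           ∎)
  where open ≤-Reasoning

%-cong-+ : ∀ d .{{_ : NonZero d}} {a b c e} → a % d ≡ b % d → c % d ≡ e % d →
  (a + c) % d ≡ (b + e) % d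
%-cong-+ d {a} {b} {c} {e} a≡b c≡e = begin
  (a + c) % d             ≡⟨ %-distribˡ-+ a c d ⟩
  (a % d + c % d) % d     ≡⟨ cong₂ (λ u v → (u + v) % d) a≡b c≡e ⟩
  (b % d + e % d) % d     ≡⟨ %-distribˡ-+ b e d ⟨
  (b + e) % d             ∎
  where open ≡-Reasoning

sumOver-cong-% : ∀ d .{{_ : NonZero d}} (S : Subset n) {g h : Fin n → ℕ} →
  (∀ x → g x % d ≡ h x % d) → sumOver S g % d ≡ sumOver S h % d
sumOver-cong-% d []            g≡h = refl
sumOver-cong-% d (inside  ∷ S) g≡h = %-cong-+ d (g≡h zero) (sumOver-cong-% d S (g≡h ∘ suc))
sumOver-cong-% d (outside ∷ S) g≡h = sumOver-cong-% d S (g≡h ∘ suc)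

%-complement : ∀ d .{{_ : NonZero d}} {a b} → a % d ≡ (d ∸ b % d) % d → (a + b) % d ≡ 0
%-complement d {a} {b} a≡-b = begin
  (a + b) % d                 ≡⟨ %-cong-+ d a≡-b (sym (m%n%n≡m%n b d)) ⟩
  ((d ∸ b % d) + b % d) % d   ≡⟨ cong (_% d) (m∸n+n≡m (<⇒≤ (m%n<n b d))) ⟩
  d % d                       ≡⟨ n%n≡0 d ⟩
  0                           ∎
  where open ≡-Reasoning

%-cancelˡ-+ : ∀ d .{{_ : NonZero d}} a {b c} → (a + b) % d ≡ 0 → (a + c) % d ≡ 0 →
  b % d ≡ c % d
%-cancelˡ-+ d a {b} {c} a+b≡0 a+c≡0 = begin
  b % d           ≡⟨ %-remove-+ˡ b (m%n≡0⇒n∣m (a + c) d a+c≡0) ⟨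
  (a + c + b) % d ≡⟨ cong (_% d) (xy∙z≈xz∙y a c b) ⟩
  (a + b + c) % d ≡⟨ %-remove-+ˡ c (m%n≡0⇒n∣m (a + b) d a+b≡0) ⟩
  c % d           ∎
  where open ≡-Reasoning

module _ {p q k : ℕ} .{{_ : NonZero p}} .{{_ : NonZero q}}
  (complete : ∀ (K : Subset p) → ∣ K ∣ ≡ k → ∀ (y : Fin p) → ∃[ A ] A ⊆ K × sumSub A % p ≡ toℕ y)
  {B : Subset q}
  (distinct-mod-p : ∀ (a b : Fin q) → a ∈ B → b ∈ B → toℕ a % p ≡ toℕ b % p → a ≡ b)
  where

  reduce : Fin q → Fin p
  reduce a = toℕ a mod p

  toℕ-reduce : ∀ a → toℕ (reduce a) ≡ toℕ a % p
  toℕ-reduce a = toℕ-fromℕ< (m%n<n (toℕ a) p)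

  reduce-injectiveOn : ∀ {K} → K ⊆ B → InjectiveOn reduce K
  reduce-injectiveOn K⊆B a∈K b∈K ra≡rb = distinct-mod-p _ _ (K⊆B a∈K) (K⊆B b∈K)
    (trans (sym (toℕ-reduce _)) (trans (cong toℕ ra≡rb) (toℕ-reduce _)))

  sumSub-image-reduce : ∀ T → InjectiveOn reduce T → sumSub (image reduce T) % p ≡ sumSub T % p
  sumSub-image-reduce T inj = begin
    sumSub (image reduce T) % p       ≡⟨ cong (_% p) (sumSub≡sumOver-toℕ (image reduce T)) ⟩
    sumOver (image reduce T) toℕ % p  ≡⟨ cong (_% p) (sumOver-image reduce T inj toℕ) ⟩
    sumOver T (toℕ ∘ reduce) % p      ≡⟨ sumOver-cong-% p T reduce≡id ⟩
    sumOver T toℕ % p                 ≡⟨ cong (_% p) (sumSub≡sumOver-toℕ T) ⟨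
    sumSub T % p                      ∎
    where
    open ≡-Reasoning
    reduce≡id : ∀ a → toℕ (reduce a) % p ≡ toℕ a % p
    reduce≡id a = trans (cong (_% p) (toℕ-reduce a)) (m%n%n≡m%n (toℕ a) p)

  ⊆-sumSub≡ : ∀ {K} → K ⊆ B → ∣ K ∣ ≡ k → (y : Fin p) →
    ∃[ T ] T ⊆ K × ∣ T ∣ ≤ k × sumSub T % p ≡ toℕ y
  ⊆-sumSub≡ {K} K⊆B ∣K∣≡k y
    with complete (image reduce K) (trans (∣image∣ reduce K (reduce-injectiveOn K⊆B)) ∣K∣≡k) y
  ... | A , A⊆K′ , ΣA≡y = T , p∩q⊆p K (preimage reduce A) , ∣T∣≤k , ΣT≡y
    where
    T = K ∩ preimage reduce A
    injT : InjectiveOn reduce T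
    injT = reduce-injectiveOn (⊆-trans (p∩q⊆p K (preimage reduce A)) K⊆B)
    imageT≡A : image reduce T ≡ A
    imageT≡A = image-∩-preimage reduce K A⊆K′
    ∣T∣≤k : ∣ T ∣ ≤ k
    ∣T∣≤k = subst₂ _≤_ (trans (cong ∣_∣ (sym imageT≡A)) (∣image∣ reduce T injT))
                       (trans (∣image∣ reduce K (reduce-injectiveOn K⊆B)) ∣K∣≡k)
                       (p⊆q⇒∣p∣≤∣q∣ A⊆K′)
    ΣT≡y : sumSub T % p ≡ toℕ y
    ΣT≡y = trans (sym (sumSub-image-reduce T injT)) (trans (cong (λ X → sumSub X % p) imageT≡A) ΣA≡y)

  module _ (3k≤∣B∣ : 3 * k ≤ ∣ B ∣)
           (zero-sum-free : ∀ A → A ⊆ B → sumSub A % p ≡ 0 → sumSub A % q ≡ 0)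
    where

    sumSub-%p≡⇒%q≡ : ∀ {V W} → V ⊆ B → W ⊆ B → ∣ V ∣ ≤ k → ∣ W ∣ ≤ k →
      sumSub V % p ≡ sumSub W % p → sumSub V % q ≡ sumSub W % q
    sumSub-%p≡⇒%q≡ {V} {W} V⊆B W⊆B ∣V∣≤k ∣W∣≤k ΣV≡ΣW
      with ⊆-ofSize k (B ─ V ─ W) (k≤∣B─V─W∣ B V W 3k≤∣B∣ ∣V∣≤k ∣W∣≤k)
    ... | K , K⊆C , ∣K∣≡k
      with ⊆-sumSub≡ (⊆-trans K⊆C (p─q─r⊆p B V W)) ∣K∣≡k ((p ∸ sumSub V % p) mod p)
    ... | T , T⊆K , _ , ΣT≡-ΣV =
      %-cancelˡ-+ q (sumSub T) (complete-to-zero V⊆B T#V refl) (complete-to-zero W⊆B T#W (sym ΣV≡ΣW))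
      where
      T⊆C : T ⊆ B ─ V ─ W
      T⊆C = ⊆-trans T⊆K K⊆C
      T#V : Disjoint T V
      T#V x∈T = x∈p─q⇒x∉q B V (p─q⊆p (B ─ V) W (T⊆C x∈T))
      T#W : Disjoint T W
      T#W x∈T = x∈p─q⇒x∉q (B ─ V) W (T⊆C x∈T)
      complete-to-zero : ∀ {X} → X ⊆ B → Disjoint T X → sumSub X % p ≡ sumSub V % p →
        (sumSub T + sumSub X) % q ≡ 0
      complete-to-zero {X} X⊆B T#X ΣX≡ΣV =
        trans (cong (_% q) (sym (sumSub-∪ T X T#X))) (zero-sum-free (T ∪ X) T∪X⊆B ΣT∪X≡0)
        where
        T∪X⊆B : T ∪ X ⊆ B
        T∪X⊆B x∈ = [ ⊆-trans T⊆C (p─q─r⊆p B V W) , X⊆B ] (x∈p∪q⁻ T X x∈)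
        ΣT≡-ΣX : sumSub T % p ≡ (p ∸ sumSub X % p) % p
        ΣT≡-ΣX = trans ΣT≡-ΣV (trans (toℕ-fromℕ< _) (cong (λ t → (p ∸ t) % p) (sym ΣX≡ΣV)))
        ΣT∪X≡0 : sumSub (T ∪ X) % p ≡ 0
        ΣT∪X≡0 = trans (cong (_% p) (sumSub-∪ T X T#X)) (%-complement p ΣT≡-ΣX)

    sumSub-%q-function : (x : Fin p) → ∃[ fx ] ∀ V → V ⊆ B → ∣ V ∣ ≤ k →
      sumSub V % p ≡ toℕ x → sumSub V % q ≡ toℕ fx
    sumSub-%q-function x with ⊆-ofSize k B (≤-trans (m≤m+n k _) 3k≤∣B∣)
    ... | K , K⊆B , ∣K∣≡k with ⊆-sumSub≡ K⊆B ∣K∣≡k x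
    ... | W , W⊆K , ∣W∣≤k , ΣW≡x = sumSub W mod q , λ V V⊆B ∣V∣≤k ΣV≡x →
      trans (sumSub-%p≡⇒%q≡ V⊆B (⊆-trans W⊆K K⊆B) ∣V∣≤k ∣W∣≤k (trans ΣV≡x (sym ΣW≡x)))
            (sym (toℕ-fromℕ< _))

-- The cases p = 0 and m = 0 are absurd (Prime p, 1 < m); for p, m successors `_modℕ_` computes
-- to `_%_`, so the hypotheses fit the module above unchanged.
lemma2p3 : (p k m : ℕ) → Prime p → 1 ≤ k
    → (∀ (K : Subset p) → ∣ K ∣ ≡ k → ∀ (y : Fin p)
         → Σ (Subset p) λ A → (A ⊆ K × (sumSub A) modℕ p ≡ toℕ y))
    → 1 < m
    → (B : Subset (m * p))
    → 4 * k < ∣ B ∣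
    → (∀ (a b : Fin (m * p)) → a ∈ B → b ∈ B
         → (toℕ a) modℕ p ≡ (toℕ b) modℕ p → a ≡ b)
    → (Σ (Fin (m * p)) λ b → (b ∈ B × ¬ (m ∣ toℕ b)))
    → ¬ (Σ (Subset (m * p)) λ A → (A ⊆ B × (sumSub A) modℕ p ≡ 0 × (sumSub A) modℕ (m * p) ≢ 0))
    → ∀ (x : Fin p) → Σ (Fin (m * p)) λ fx → (∀ (V : Subset (m * p)) → V ⊆ B → ∣ V ∣ ≤ k
         → (sumSub V) modℕ p ≡ toℕ x → (sumSub V) modℕ (m * p) ≡ toℕ fx)
lemma2p3 p@(suc _) k m@(suc _) _ _ complete _ B 4k<∣B∣ distinct-mod-p _ no-bad-subset =
  sumSub-%q-function complete distinct-mod-p 3k≤∣B∣ zero-sum-free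
  where
  3k≤∣B∣ : 3 * k ≤ ∣ B ∣
  3k≤∣B∣ = ≤-trans (*-monoˡ-≤ k (n≤1+n 3)) (<⇒≤ 4k<∣B∣)
  zero-sum-free : ∀ A → A ⊆ B → sumSub A % p ≡ 0 → sumSub A % (m * p) ≡ 0
  zero-sum-free A A⊆B ΣA≡0 = decidable-stable (sumSub A % (m * p) ≟ 0)
    λ ΣA≢0 → no-bad-subset (A , A⊆B , ΣA≡0 , ΣA≢0)
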